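{- For every $n\in\mathbb{N}$ there are MILP instances $I_1$ and $I_2$ with constraint matrices $A_1$ and $A_2$ (of size depending on $n$) such that $A_1$ has constant primal, dual and incidence treewidth and $\|A_1\|_\infty=2$, $A_2$ is a 4-block $n$-fold matrix all of whose blocks are the $1\times 1$ matrix $(1)$, and the fractionality of $I_1$ is $2^{\Omega(n)}$ and the fractionality of $I_2$ is $\Omega(n)$.
   Context: An MILP instance is $\min\{\mathbf{c}\mathbf{x}\mid A\mathbf{x}=\mathbf{b},\ \mathbf{l}\le\mathbf{x}\le\mathbf{u},\ \mathbf{x}\in\mathbb{Z}^z\times\mathbb{Q}^q\}$ with integral data. Its fractionality is the minimum, over all optimal solutions, of the largest denominator (in lowest terms) of an entry of the solution. The primal graph of $A$ has a vertex per column, columns adjacent iff they share a row with non-zeros in both; the dual graph is the primal graph of $A^{\intercal}$; the incidence graph is the bipartite graph between rows and columns with an edge $\{r,c\}$ iff $A_{r,c}\neq 0$; primal/dual/incidence treewidth is the treewidth of these graphs. A 4-block $n$-fold matrix has the form $\begin{pmatrix}C & D & D &\cdots & D\\ B & E & & & \\ B & & E & & \\ \vdots & & &\ddots & \\ B & & & & E\end{pmatrix}$ (zero elsewhere) for blocks $B,C,D,E$. $\|A\|_\infty$ is the largest absolute value of an entry. -}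

module Defs where

open import Data.Nat as ℕ using (ℕ; zero; suc; _⊔_)
open import Data.Fin using (Fin; zero; suc; toℕ)
open import Data.Integer as ℤ using (ℤ; +_; ∣_∣)
open import Data.Rational as ℚ using (ℚ; 0ℚ; ↧ₙ_)
open import Data.Bool using (Bool; true; false)
open import Data.List using (List; length)
open import Data.List.Membership.Propositional using (_∈_)
open import Data.Sum using (_⊎_; inj₁; inj₂)
open import Data.Product using (Σ; ∃; _×_; _,_)
open import Relation.Binary.PropositionalEquality using (_≡_; _≢_)
open import Relation.Nullary using (yes; no)
open import Data.Empty using (⊥)

∑ : ∀ {n} → (Fin n → ℚ) → ℚ
∑ {zero}  f = 0ℚ
∑ {suc n} f = f zero ℚ.+ ∑ (λ i → f (suc i))

maxℕ : ∀ {n} → (Fin n → ℕ) → ℕ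
maxℕ {zero}  f = 0
maxℕ {suc n} f = f zero ⊔ maxℕ (λ i → f (suc i))

ι : ℤ → ℚ
ι z = z ℚ./ 1

Matrix : ℕ → ℕ → Set
Matrix m N = Fin m → Fin N → ℤ

transpose : ∀ {m N} → Matrix m N → Matrix N m
transpose A j i = A i j

-- MILP instances  min { c x | A x = b, l ≤ x ≤ u, x_j ∈ ℤ for integer columns j }
-- (integral data; isInt j = true means column j is an integer variable)

record MILP (m N : ℕ) : Set where
  field
    A     : Matrix m N
    b     : Fin m → ℤ
    l     : Fin N → ℤ
    u     : Fin N → ℤ
    c     : Fin N → ℤ
    isInt : Fin N → Bool

module _ {m N : ℕ} (I : MILP m N) where
  open MILP I

  objective : (Fin N → ℚ) → ℚ
  objective x = ∑ (λ j → ι (c j) ℚ.* x j)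

  Feasible : (Fin N → ℚ) → Set
  Feasible x =
      (∀ i → ∑ (λ j → ι (A i j) ℚ.* x j) ≡ ι (b i))
    × (∀ j → ι (l j) ℚ.≤ x j)
    × (∀ j → x j ℚ.≤ ι (u j))
    × (∀ j → isInt j ≡ true → ↧ₙ (x j) ≡ 1)

  Optimal : (Fin N → ℚ) → Set
  Optimal x = Feasible x × (∀ y → Feasible y → objective x ℚ.≤ objective y)

  -- largest denominator (in lowest terms; ℚ is normalised) of an entry
  maxDen : (Fin N → ℚ) → ℕ
  maxDen x = maxℕ (λ j → ↧ₙ (x j))

  Fractionality : ℕ → Set
  Fractionality d =
      (Σ (Fin N → ℚ) λ x → Optimal x × maxDen x ≡ d)
    × (∀ x → Optimal x → d ℕ.≤ maxDen x)

NormInf≡ : ∀ {m N} → Matrix m N → ℕ → Set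
NormInf≡ A k = (∀ i j → ∣ A i j ∣ ℕ.≤ k) × (∃ λ i → ∃ λ j → ∣ A i j ∣ ≡ k)

Graph : Set → Set₁
Graph V = V → V → Set

primalGraph : ∀ {m N} → Matrix m N → Graph (Fin N)
primalGraph A j j' = j ≢ j' × ∃ λ i → (A i j ≢ + 0) × (A i j' ≢ + 0)

dualGraph : ∀ {m N} → Matrix m N → Graph (Fin m)
dualGraph A = primalGraph (transpose A)

incidenceGraph : ∀ {m N} → Matrix m N → Graph (Fin m ⊎ Fin N)
incidenceGraph A (inj₁ i) (inj₂ j) = A i j ≢ + 0
incidenceGraph A (inj₂ j) (inj₁ i) = A i j ≢ + 0
incidenceGraph A (inj₁ _) (inj₁ _) = ⊥
incidenceGraph A (inj₂ _) (inj₂ _) = ⊥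

-- A finite tree with node set Fin (suc t), rooted at zero: node (suc i) has
-- parent (parent i), whose index is at most i.  Every finite tree arises so.
record Tree : Set where
  field
    t       : ℕ
    parent  : Fin t → Fin (suc t)
    parent< : ∀ i → toℕ (parent i) ℕ.≤ toℕ i

  Node : Set
  Node = Fin (suc t)

  TEdge : Node → Node → Set
  TEdge a b = ∃ λ i → (a ≡ suc i × b ≡ parent i) ⊎ (b ≡ suc i × a ≡ parent i)

  data WalkIn (S : Node → Set) : Node → Node → Set where
    here : ∀ {a} → S a → WalkIn S a a
    step : ∀ {a b c} → S a → TEdge a b → WalkIn S b c → WalkIn S a c

record TreeDecomposition {V : Set} (G : Graph V) : Set₁ where
  field
    tree : Tree
  open Tree tree public
  field
    bag        : Node → List V
    covers     : ∀ v → ∃ λ a → v ∈ bag a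
    edgeCover  : ∀ u v → G u v → ∃ λ a → (u ∈ bag a × v ∈ bag a)
    connected  : ∀ v a b → v ∈ bag a → v ∈ bag b → WalkIn (λ x → v ∈ bag x) a b

  WidthAtMost : ℕ → Set
  WidthAtMost w = ∀ a → length (bag a) ℕ.≤ suc w

TreewidthAtMost : ∀ {V} → Graph V → ℕ → Set₁
TreewidthAtMost G w = Σ (TreeDecomposition G) λ T → TreeDecomposition.WidthAtMost T w

-- The 4-block n-fold matrix with B = C = D = E = (1):
-- (n+1) × (n+1), row 0 is all ones; row (suc k) has a 1 in column 0 and
-- in column (suc k), zero elsewhere.

fourBlockOnes : (n : ℕ) → Matrix (suc n) (suc n)
fourBlockOnes n zero    _       = + 1
fourBlockOnes n (suc k) zero    = + 1
fourBlockOnes n (suc k) (suc j) with toℕ k ℕ.≟ toℕ j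
... | yes _ = + 1
... | no _  = + 0

-- Both instances have a unique feasible point and zero cost, so their fractionality is
-- the largest denominator of that point.  In I₁ the bidiagonal rows x₀ = 1 and
-- x_r = 2 x_{r+1} force x_r = 2^{-r}, while its primal, dual and incidence graphs are
-- paths and so have treewidth 1.  In I₂, with n ≥ 2 leaves, the rows x₀ + x_k = 0 and
-- x₀ + Σ_k x_k = −1 force x₀ = 1/(n − 1).

module Submission where

open import Defs
open import Data.Nat using (ℕ; _≤_; _*_; _^_; suc)
open import Data.Product using (Σ; ∃; _×_)
open import Relation.Binary.PropositionalEquality using (_≡_)

open import Data.Bool using (false)
open import Data.Empty using (⊥-elim)
open import Data.Fin as Fin using (Fin; toℕ; fromℕ<; inject₁; fromℕ)
import Data.Fin.Properties as Finₚ
open import Data.Integer as ℤ using (ℤ; +_; -[1+_])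
import Data.Integer.Properties as ℤₚ
open import Data.List using (List; []; _∷_)
open import Data.List.Membership.Propositional using (_∈_)
open import Data.List.Relation.Unary.Any using (here; there)
open import Data.Nat as ℕ using (zero; z≤n; s≤s; NonZero)
import Data.Nat.Properties as ℕₚ
open import Data.Nat.Coprimality using (1-coprimeTo) renaming (sym to Coprime-sym)
open import Data.Product using (_,_; proj₁; proj₂)
open import Data.Rational as ℚ using (ℚ; mkℚ; 0ℚ; 1ℚ; ½; -_; *≤*)
  renaming (_+_ to _+ℚ_; _*_ to _*ℚ_)
import Data.Rational.Properties as ℚₚ
open import Data.Rational.Solver using (module +-*-Solver)
open import Data.Sum using (_⊎_; inj₁; inj₂)
open import Relation.Binary.PropositionalEquality
  using (_≢_; refl; sym; trans; cong; cong₂; subst; module ≡-Reasoning)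
open import Relation.Nullary using (yes; no)
open import Function using (_∘_)
open import Algebra.Properties.Group ℚₚ.+-0-group using (inverseʳ-unique)

open +-*-Solver

2*suc : ∀ n → 2 * suc n ≡ suc (suc (2 * n))
2*suc n = ℕₚ.*-distribˡ-+ 2 1 n

even⊎odd : ∀ a → ∃ λ q → a ≡ 2 * q ⊎ a ≡ suc (2 * q)
even⊎odd zero = 0 , inj₁ refl
even⊎odd (suc a) with even⊎odd a
... | q , inj₁ a≡2q   = q , inj₂ (cong suc a≡2q)
... | q , inj₂ a≡1+2q = suc q , inj₁ (trans (cong suc a≡1+2q) (sym (2*suc q)))

m≤m^[1+n] : ∀ m .{{_ : NonZero m}} n → m ≤ m ^ suc n
m≤m^[1+n] m n = ℕₚ.m≤m*n m (m ^ n) {{ℕₚ.m^n≢0 m n}}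

module ConsecutiveNumbering
  {V : Set} (G : Graph V) (M : ℕ) (number : V → ℕ)
  (number≤M : ∀ v → number v ≤ M)
  (number-injective : ∀ {u v} → number u ≡ number v → u ≡ v)
  (numbered : ∀ a → a ≤ M → ∃ λ v → number v ≡ a)
  (edge⇒consecutive : ∀ {u v} → G u v → number v ≡ suc (number u) ⊎ number u ≡ suc (number v))
  where

  path : Tree
  path = record { t = M ; parent = inject₁ ; parent< = λ i → ℕₚ.≤-reflexive (Finₚ.toℕ-inject₁ i) }

  open Tree path using (Node; WalkIn; here; step)

  vertexAt : Node → V
  vertexAt a = proj₁ (numbered (toℕ a) (Finₚ.toℕ≤pred[n] a))

  number-vertexAt : ∀ a → number (vertexAt a) ≡ toℕ a
  number-vertexAt a = proj₂ (numbered (toℕ a) (Finₚ.toℕ≤pred[n] a))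

  number-vertexAt-inject₁ : ∀ i → number (vertexAt (inject₁ i)) ≡ toℕ i
  number-vertexAt-inject₁ i = trans (number-vertexAt (inject₁ i)) (Finₚ.toℕ-inject₁ i)

  bag : Node → List V
  bag Fin.zero    = vertexAt Fin.zero ∷ []
  bag (Fin.suc i) = vertexAt (Fin.suc i) ∷ vertexAt (inject₁ i) ∷ []

  vertexAt∈bag : ∀ a → vertexAt a ∈ bag a
  vertexAt∈bag Fin.zero    = here refl
  vertexAt∈bag (Fin.suc i) = here refl

  ∈bag⇒ : ∀ {v} a → v ∈ bag a → toℕ a ≡ number v ⊎ toℕ a ≡ suc (number v)
  ∈bag⇒ Fin.zero    (here refl)         = inj₁ (sym (number-vertexAt Fin.zero))
  ∈bag⇒ (Fin.suc i) (here refl)         = inj₁ (sym (number-vertexAt (Fin.suc i)))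
  ∈bag⇒ (Fin.suc i) (there (here refl)) = inj₂ (cong suc (sym (number-vertexAt-inject₁ i)))

  covers : ∀ v → ∃ λ a → v ∈ bag a
  covers v = a , subst (_∈ bag a) (number-injective number-a) (vertexAt∈bag a)
    where
    a = fromℕ< (s≤s (number≤M v))
    number-a : number (vertexAt a) ≡ number v
    number-a = trans (number-vertexAt a) (Finₚ.toℕ-fromℕ< (s≤s (number≤M v)))

  consecutive∈bag : ∀ {u v} → number v ≡ suc (number u) → ∃ λ a → u ∈ bag a × v ∈ bag a
  consecutive∈bag {u} {v} v≡1+u = Fin.suc i , there (here u≡) , here v≡
    where
    u<M : number u ℕ.< M
    u<M = subst (_≤ M) v≡1+u (number≤M v)
    i = fromℕ< u<M
    u≡ : u ≡ vertexAt (inject₁ i)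
    u≡ = number-injective (sym (trans (number-vertexAt-inject₁ i) (Finₚ.toℕ-fromℕ< u<M)))
    v≡ : v ≡ vertexAt (Fin.suc i)
    v≡ = number-injective (trans v≡1+u (trans (cong suc (sym (Finₚ.toℕ-fromℕ< u<M)))
                                             (sym (number-vertexAt (Fin.suc i)))))

  edgeCover : ∀ u v → G u v → ∃ λ a → u ∈ bag a × v ∈ bag a
  edgeCover u v uv with edge⇒consecutive uv
  ... | inj₁ v≡1+u = consecutive∈bag v≡1+u
  ... | inj₂ u≡1+v = let a , v∈ , u∈ = consecutive∈bag u≡1+v in a , u∈ , v∈

  connected : ∀ v a b → v ∈ bag a → v ∈ bag b → WalkIn (λ x → v ∈ bag x) a b
  connected v a b v∈a v∈b with ∈bag⇒ a v∈a | ∈bag⇒ b v∈b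
  ... | inj₁ p | inj₁ q = subst (WalkIn _ a) (Finₚ.toℕ-injective (trans p (sym q))) (here v∈a)
  ... | inj₂ p | inj₂ q = subst (WalkIn _ a) (Finₚ.toℕ-injective (trans p (sym q))) (here v∈a)
  connected v a (Fin.suc i) v∈a v∈b | inj₁ p | inj₂ q =
    step v∈a (i , inj₂ (refl , Finₚ.toℕ-injective a≡i)) (here v∈b)
    where a≡i = trans p (trans (ℕₚ.suc-injective (sym q)) (sym (Finₚ.toℕ-inject₁ i)))
  connected v (Fin.suc i) b v∈a v∈b | inj₂ p | inj₁ q =
    step v∈a (i , inj₁ (refl , Finₚ.toℕ-injective b≡i)) (here v∈b)
    where b≡i = trans q (trans (ℕₚ.suc-injective (sym p)) (sym (Finₚ.toℕ-inject₁ i)))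

  treewidth≤1 : TreewidthAtMost G 1
  treewidth≤1 = decomposition , λ { Fin.zero → s≤s z≤n ; (Fin.suc i) → s≤s (s≤s z≤n) }
    where
    decomposition : TreeDecomposition G
    decomposition = record
      { tree = path ; bag = bag ; covers = covers ; edgeCover = edgeCover ; connected = connected }

pathLike⇒treewidth≤1 : ∀ {n} (G : Graph (Fin (suc n))) →
  (∀ {u v} → G u v → toℕ v ≡ suc (toℕ u) ⊎ toℕ u ≡ suc (toℕ v)) → TreewidthAtMost G 1
pathLike⇒treewidth≤1 {n} G consecutive =
  ConsecutiveNumbering.treewidth≤1 G n toℕ Finₚ.toℕ≤pred[n] Finₚ.toℕ-injective
    (λ a a≤n → fromℕ< (s≤s a≤n) , Finₚ.toℕ-fromℕ< (s≤s a≤n)) consecutive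

∑-cong : ∀ {N} {f g : Fin N → ℚ} → (∀ j → f j ≡ g j) → ∑ f ≡ ∑ g
∑-cong {zero}  f≡g = refl
∑-cong {suc N} f≡g = cong₂ _+ℚ_ (f≡g Fin.zero) (∑-cong (λ j → f≡g (Fin.suc j)))

∑-zero : ∀ {N} {f : Fin N → ℚ} → (∀ j → f j ≡ 0ℚ) → ∑ f ≡ 0ℚ
∑-zero {zero}  f≡0 = refl
∑-zero {suc N} f≡0 = cong₂ _+ℚ_ (f≡0 Fin.zero) (∑-zero (λ j → f≡0 (Fin.suc j)))

ι≡mkℚ : ∀ N → ι (+ N) ≡ mkℚ (+ N) 0 (Coprime-sym (1-coprimeTo N))
ι≡mkℚ N = ℚₚ.↥p/↧p≡p (mkℚ (+ N) 0 (Coprime-sym (1-coprimeTo N)))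

ι-suc : ∀ N → ι (+ suc N) ≡ 1ℚ +ℚ ι (+ N)
ι-suc N = sym (trans (cong (1ℚ +ℚ_) (ι≡mkℚ N))
                     (cong (λ z → (+ 1 ℤ.+ z) ℚ./ 1) (ℤₚ.*-identityʳ (+ N))))

∑-const : ∀ N p → ∑ {N} (λ _ → p) ≡ ι (+ N) *ℚ p
∑-const zero    p = sym (ℚₚ.*-zeroˡ p)
∑-const (suc N) p = begin
  p +ℚ ∑ {N} (λ _ → p)        ≡⟨ cong₂ _+ℚ_ (sym (ℚₚ.*-identityˡ p)) (∑-const N p) ⟩
  1ℚ *ℚ p +ℚ ι (+ N) *ℚ p     ≡⟨ sym (ℚₚ.*-distribʳ-+ p 1ℚ (ι (+ N))) ⟩
  (1ℚ +ℚ ι (+ N)) *ℚ p        ≡⟨ cong (_*ℚ p) (sym (ι-suc N)) ⟩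
  ι (+ suc N) *ℚ p            ∎
  where open ≡-Reasoning

∑-select : ∀ {N} (k : Fin N) (a : Fin N → ℤ) (x : Fin N → ℚ) →
  a k ≡ + 1 → (∀ j → j ≢ k → a j ≡ + 0) → ∑ (λ j → ι (a j) *ℚ x j) ≡ x k
∑-select Fin.zero a x aₖ≡1 a≡0 = begin
  ι (a Fin.zero) *ℚ x Fin.zero +ℚ ∑ (λ j → ι (a (Fin.suc j)) *ℚ x (Fin.suc j))
    ≡⟨ cong₂ _+ℚ_ (cong (λ z → ι z *ℚ x Fin.zero) aₖ≡1) (∑-zero rest≡0) ⟩
  1ℚ *ℚ x Fin.zero +ℚ 0ℚ
    ≡⟨ trans (ℚₚ.+-identityʳ _) (ℚₚ.*-identityˡ _) ⟩
  x Fin.zero ∎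
  where
  open ≡-Reasoning
  rest≡0 : ∀ j → ι (a (Fin.suc j)) *ℚ x (Fin.suc j) ≡ 0ℚ
  rest≡0 j = trans (cong (λ z → ι z *ℚ x (Fin.suc j)) (a≡0 (Fin.suc j) λ ())) (ℚₚ.*-zeroˡ (x (Fin.suc j)))
∑-select (Fin.suc k) a x aₖ≡1 a≡0 = begin
  ι (a Fin.zero) *ℚ x Fin.zero +ℚ ∑ (λ j → ι (a (Fin.suc j)) *ℚ x (Fin.suc j))
    ≡⟨ cong₂ _+ℚ_ (trans (cong (λ z → ι z *ℚ x Fin.zero) (a≡0 Fin.zero λ ())) (ℚₚ.*-zeroˡ (x Fin.zero)))
                  (∑-select k (λ j → a (Fin.suc j)) (λ j → x (Fin.suc j)) aₖ≡1
                     (λ j j≢k → a≡0 (Fin.suc j) (λ sj≡sk → j≢k (Finₚ.suc-injective sj≡sk)))) ⟩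
  0ℚ +ℚ x (Fin.suc k)
    ≡⟨ ℚₚ.+-identityˡ _ ⟩
  x (Fin.suc k) ∎
  where open ≡-Reasoning

maxℕ-cong : ∀ {N} {f g : Fin N → ℕ} → (∀ j → f j ≡ g j) → maxℕ f ≡ maxℕ g
maxℕ-cong {zero}  f≡g = refl
maxℕ-cong {suc N} f≡g = cong₂ ℕ._⊔_ (f≡g Fin.zero) (maxℕ-cong (λ j → f≡g (Fin.suc j)))

f≤maxℕ : ∀ {N} (f : Fin N → ℕ) j → f j ≤ maxℕ f
f≤maxℕ f Fin.zero    = ℕₚ.m≤m⊔n _ _
f≤maxℕ f (Fin.suc j) = ℕₚ.≤-trans (f≤maxℕ (λ i → f (Fin.suc i)) j) (ℕₚ.m≤n⊔m _ _)

1/[_] : (d : ℕ) .{{_ : NonZero d}} → ℚ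
1/[ suc k ] = mkℚ (+ 1) k (1-coprimeTo (suc k))

↧ₙ-1/[] : ∀ d .{{_ : NonZero d}} → ℚ.↧ₙ 1/[ d ] ≡ d
↧ₙ-1/[] (suc k) = refl

½*1/[] : ∀ d .{{_ : NonZero d}} → ½ *ℚ 1/[ d ] ≡ 1/[ 2 * d ] {{ℕₚ.m*n≢0 2 d}}
½*1/[] (suc k) = ℚₚ.normalize-coprime (1-coprimeTo (2 * suc k))

ι*1/[] : ∀ d .{{_ : NonZero d}} → ι (+ d) *ℚ 1/[ d ] ≡ 1ℚ
ι*1/[] (suc k) = trans (cong (_*ℚ 1/[ suc k ]) (ι≡mkℚ (suc k)))
                       (ℚₚ.*-inverseʳ (mkℚ (+ suc k) 0 (Coprime-sym (1-coprimeTo (suc k)))))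

ι*x≡1⇒x≡1/[] : ∀ d .{{_ : NonZero d}} x → ι (+ d) *ℚ x ≡ 1ℚ → x ≡ 1/[ d ]
ι*x≡1⇒x≡1/[] d x dx≡1 = begin
  x                          ≡⟨ sym (ℚₚ.*-identityˡ x) ⟩
  1ℚ *ℚ x                    ≡⟨ cong (_*ℚ x) (sym (trans (ℚₚ.*-comm 1/[ d ] (ι (+ d))) (ι*1/[] d))) ⟩
  (1/[ d ] *ℚ ι (+ d)) *ℚ x  ≡⟨ ℚₚ.*-assoc 1/[ d ] (ι (+ d)) x ⟩
  1/[ d ] *ℚ (ι (+ d) *ℚ x)  ≡⟨ cong (1/[ d ] *ℚ_) dx≡1 ⟩
  1/[ d ] *ℚ 1ℚ              ≡⟨ ℚₚ.*-identityʳ 1/[ d ] ⟩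
  1/[ d ]                    ∎
  where open ≡-Reasoning

0≤1/[] : ∀ d .{{_ : NonZero d}} → 0ℚ ℚ.≤ 1/[ d ]
0≤1/[] (suc k) = *≤* (ℤ.+≤+ z≤n)

1/[]≤1 : ∀ d .{{_ : NonZero d}} → 1/[ d ] ℚ.≤ 1ℚ
1/[]≤1 (suc k) = *≤* (ℤ.+≤+ (s≤s z≤n))

module _ {m N} (I : MILP m N) (cost≡0 : ∀ j → MILP.c I j ≡ + 0) where

  objective≡0 : ∀ x → objective I x ≡ 0ℚ
  objective≡0 x = ∑-zero (λ j → trans (cong (λ z → ι z *ℚ x j) (cost≡0 j)) (ℚₚ.*-zeroˡ (x j)))

  uniqueFeasible⇒Fractionality : ∀ x → Feasible I x → (∀ y → Feasible I y → ∀ j → y j ≡ x j) →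
                                 Fractionality I (maxDen I x)
  uniqueFeasible⇒Fractionality x x-feasible unique = (x , optimal , refl) , minimal
    where
    optimal : Optimal I x
    optimal = x-feasible , λ y _ → ℚₚ.≤-reflexive (trans (objective≡0 x) (sym (objective≡0 y)))
    minimal : ∀ y → Optimal I y → maxDen I x ≤ maxDen I y
    minimal y (y-feasible , _) =
      ℕₚ.≤-reflexive (maxℕ-cong (λ j → cong ℚ.↧ₙ_ (sym (unique y y-feasible j))))

-- Row 0 reads x₀ = 1 and row r + 1 reads x_r − 2 x_{r+1} = 0.
halving : ℕ → ℕ → ℤ
halving zero          zero          = + 1
halving zero          (suc j)       = + 0
halving (suc zero)    zero          = + 1
halving (suc zero)    (suc zero)    = -[1+ 1 ]
halving (suc zero)    (suc (suc j)) = + 0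
halving (suc (suc r)) zero          = + 0
halving (suc (suc r)) (suc j)       = halving (suc r) j

halving-support : ∀ r j → halving r j ≢ + 0 → r ≡ j ⊎ r ≡ suc j
halving-support zero          zero          _   = inj₁ refl
halving-support zero          (suc j)       h≢0 = ⊥-elim (h≢0 refl)
halving-support (suc zero)    zero          _   = inj₂ refl
halving-support (suc zero)    (suc zero)    _   = inj₁ refl
halving-support (suc zero)    (suc (suc j)) h≢0 = ⊥-elim (h≢0 refl)
halving-support (suc (suc r)) zero          h≢0 = ⊥-elim (h≢0 refl)
halving-support (suc (suc r)) (suc j)       h≢0 with halving-support (suc r) j h≢0
... | inj₁ r≡j  = inj₁ (cong suc r≡j)
... | inj₂ r≡1+j = inj₂ (cong suc r≡1+j)

∣halving∣≤2 : ∀ r j → ℤ.∣ halving r j ∣ ≤ 2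
∣halving∣≤2 zero          zero          = s≤s z≤n
∣halving∣≤2 zero          (suc j)       = z≤n
∣halving∣≤2 (suc zero)    zero          = s≤s z≤n
∣halving∣≤2 (suc zero)    (suc zero)    = s≤s (s≤s z≤n)
∣halving∣≤2 (suc zero)    (suc (suc j)) = z≤n
∣halving∣≤2 (suc (suc r)) zero          = z≤n
∣halving∣≤2 (suc (suc r)) (suc j)       = ∣halving∣≤2 (suc r) j

halvingMatrix : ∀ n → Matrix (suc n) (suc n)
halvingMatrix n i j = halving (toℕ i) (toℕ j)

halvingMatrix-norm : ∀ n → NormInf≡ (halvingMatrix (suc n)) 2
halvingMatrix-norm n = (λ i j → ∣halving∣≤2 (toℕ i) (toℕ j)) , Fin.suc Fin.zero , Fin.suc Fin.zero , refl

halvingMatrix-primal : ∀ n → TreewidthAtMost (primalGraph (halvingMatrix n)) 1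
halvingMatrix-primal n = pathLike⇒treewidth≤1 _ consecutive
  where
  consecutive : ∀ {u v} → primalGraph (halvingMatrix n) u v →
                toℕ v ≡ suc (toℕ u) ⊎ toℕ u ≡ suc (toℕ v)
  consecutive (u≢v , r , ru≢0 , rv≢0)
    with halving-support (toℕ r) _ ru≢0 | halving-support (toℕ r) _ rv≢0
  ... | inj₁ p | inj₁ q = ⊥-elim (u≢v (Finₚ.toℕ-injective (trans (sym p) q)))
  ... | inj₁ p | inj₂ q = inj₂ (trans (sym p) q)
  ... | inj₂ p | inj₁ q = inj₁ (trans (sym q) p)
  ... | inj₂ p | inj₂ q = ⊥-elim (u≢v (Finₚ.toℕ-injective (ℕₚ.suc-injective (trans (sym p) q))))

halvingMatrix-dual : ∀ n → TreewidthAtMost (dualGraph (halvingMatrix n)) 1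
halvingMatrix-dual n = pathLike⇒treewidth≤1 _ consecutive
  where
  consecutive : ∀ {u v} → dualGraph (halvingMatrix n) u v →
                toℕ v ≡ suc (toℕ u) ⊎ toℕ u ≡ suc (toℕ v)
  consecutive (u≢v , j , uj≢0 , vj≢0)
    with halving-support _ (toℕ j) uj≢0 | halving-support _ (toℕ j) vj≢0
  ... | inj₁ p | inj₁ q = ⊥-elim (u≢v (Finₚ.toℕ-injective (trans p (sym q))))
  ... | inj₁ p | inj₂ q = inj₁ (trans q (cong suc (sym p)))
  ... | inj₂ p | inj₁ q = inj₂ (trans p (cong suc (sym q)))
  ... | inj₂ p | inj₂ q = ⊥-elim (u≢v (Finₚ.toℕ-injective (trans p (sym q))))

-- Rows get the even and columns the odd numbers, so that the incidence graph
-- r₀ – c₀ – r₁ – c₁ – ⋯ is numbered consecutively.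
halvingMatrix-incidence : ∀ n → TreewidthAtMost (incidenceGraph (halvingMatrix n)) 1
halvingMatrix-incidence n =
  ConsecutiveNumbering.treewidth≤1 _ (suc (2 * n)) number number≤ number-injective numbered consecutive
  where
  number : Fin (suc n) ⊎ Fin (suc n) → ℕ
  number (inj₁ r) = 2 * toℕ r
  number (inj₂ j) = suc (2 * toℕ j)

  number≤ : ∀ v → number v ≤ suc (2 * n)
  number≤ (inj₁ r) = ℕₚ.m≤n⇒m≤1+n (ℕₚ.*-monoʳ-≤ 2 (Finₚ.toℕ≤pred[n] r))
  number≤ (inj₂ j) = s≤s (ℕₚ.*-monoʳ-≤ 2 (Finₚ.toℕ≤pred[n] j))

  number-injective : ∀ {u v} → number u ≡ number v → u ≡ v
  number-injective {inj₁ r} {inj₁ s} p = cong inj₁ (Finₚ.toℕ-injective (ℕₚ.*-cancelˡ-≡ _ _ 2 p))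
  number-injective {inj₂ j} {inj₂ k} p =
    cong inj₂ (Finₚ.toℕ-injective (ℕₚ.*-cancelˡ-≡ _ _ 2 (ℕₚ.suc-injective p)))
  number-injective {inj₁ r} {inj₂ k} p = ⊥-elim (ℕₚ.even≢odd (toℕ r) (toℕ k) p)
  number-injective {inj₂ j} {inj₁ s} p = ⊥-elim (ℕₚ.even≢odd (toℕ s) (toℕ j) (sym p))

  numbered : ∀ a → a ≤ suc (2 * n) → ∃ λ v → number v ≡ a
  numbered a a≤ with even⊎odd a
  ... | q , inj₁ a≡2q = inj₁ (fromℕ< q<) , trans (cong (2 *_) (Finₚ.toℕ-fromℕ< q<)) (sym a≡2q)
    where
    q< : q ℕ.< suc n
    q< = ℕₚ.*-cancelˡ-< 2 _ _ (subst (ℕ._< 2 * suc n) a≡2q (subst (a ℕ.<_) (sym (2*suc n)) (s≤s a≤)))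
  ... | q , inj₂ a≡1+2q = inj₂ (fromℕ< q<) , trans (cong (suc ∘ (2 *_)) (Finₚ.toℕ-fromℕ< q<)) (sym a≡1+2q)
    where
    q< : q ℕ.< suc n
    q< = s≤s (ℕₚ.*-cancelˡ-≤ 2 (ℕ.s≤s⁻¹ (subst (_≤ suc (2 * n)) a≡1+2q a≤)))

  consecutive : ∀ {u v} → incidenceGraph (halvingMatrix n) u v →
                number v ≡ suc (number u) ⊎ number u ≡ suc (number v)
  consecutive {inj₁ r} {inj₂ j} rj≢0 with halving-support (toℕ r) (toℕ j) rj≢0
  ... | inj₁ r≡j   = inj₁ (cong (suc ∘ (2 *_)) (sym r≡j))
  ... | inj₂ r≡1+j = inj₂ (trans (cong (2 *_) r≡1+j) (2*suc (toℕ j)))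
  consecutive {inj₂ j} {inj₁ r} rj≢0 with halving-support (toℕ r) (toℕ j) rj≢0
  ... | inj₁ r≡j   = inj₂ (cong (suc ∘ (2 *_)) (sym r≡j))
  ... | inj₂ r≡1+j = inj₁ (trans (cong (2 *_) r≡1+j) (2*suc (toℕ j)))

halving-row₀ : ∀ {n} (x : Fin (suc n) → ℚ) → ∑ (λ j → ι (halvingMatrix n Fin.zero j) *ℚ x j) ≡ x Fin.zero
halving-row₀ {n} x = ∑-select Fin.zero (halvingMatrix n Fin.zero) x refl
  λ { Fin.zero 0≢0 → ⊥-elim (0≢0 refl) ; (Fin.suc j) _ → refl }

halving-rowₛ : ∀ {n} (i : Fin n) (x : Fin (suc n) → ℚ) →
  ∑ (λ j → ι (halvingMatrix n (Fin.suc i) j) *ℚ x j) ≡ ι (+ 1) *ℚ x (inject₁ i) +ℚ ι -[1+ 1 ] *ℚ x (Fin.suc i)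
halving-rowₛ {suc n} Fin.zero x =
  cong (ι (+ 1) *ℚ x Fin.zero +ℚ_)
    (trans (cong (ι -[1+ 1 ] *ℚ x (Fin.suc Fin.zero) +ℚ_)
                 (∑-zero (λ j → ℚₚ.*-zeroˡ (x (Fin.suc (Fin.suc j))))))
           (ℚₚ.+-identityʳ _))
halving-rowₛ {suc n} (Fin.suc i) x =
  trans (cong₂ _+ℚ_ (ℚₚ.*-zeroˡ (x Fin.zero)) (halving-rowₛ i (λ j → x (Fin.suc j))))
        (ℚₚ.+-identityˡ _)

halvingRow≡0⇒ : ∀ a b → ι (+ 1) *ℚ a +ℚ ι -[1+ 1 ] *ℚ b ≡ 0ℚ → b ≡ ½ *ℚ a
halvingRow≡0⇒ a b row≡0 = begin
  b                                                      ≡⟨ solveForB a b ⟩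
  ½ *ℚ a +ℚ - (½ *ℚ (ι (+ 1) *ℚ a +ℚ ι -[1+ 1 ] *ℚ b))  ≡⟨ cong (λ z → ½ *ℚ a +ℚ - (½ *ℚ z)) row≡0 ⟩
  ½ *ℚ a +ℚ - (½ *ℚ 0ℚ)                                 ≡⟨ ℚₚ.+-identityʳ _ ⟩
  ½ *ℚ a                                                 ∎
  where
  open ≡-Reasoning
  solveForB : ∀ a b → b ≡ ½ *ℚ a +ℚ - (½ *ℚ (ι (+ 1) *ℚ a +ℚ ι -[1+ 1 ] *ℚ b))
  solveForB = solve 2 (λ a b → b := con ½ :* a :+ :- (con ½ :* (con (ι (+ 1)) :* a :+ con (ι -[1+ 1 ]) :* b))) refl

halfPower : ℕ → ℚ
halfPower r = 1/[ 2 ^ r ] {{ℕₚ.m^n≢0 2 r}}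

halfPower-suc : ∀ r → halfPower (suc r) ≡ ½ *ℚ halfPower r
halfPower-suc r = sym (½*1/[] (2 ^ r) {{ℕₚ.m^n≢0 2 r}})

↧ₙ-halfPower : ∀ r → ℚ.↧ₙ halfPower r ≡ 2 ^ r
↧ₙ-halfPower r = ↧ₙ-1/[] (2 ^ r) {{ℕₚ.m^n≢0 2 r}}

halvingInstance : ∀ n → MILP (suc n) (suc n)
halvingInstance n = record
  { A = halvingMatrix n
  ; b = λ { Fin.zero → + 1 ; (Fin.suc _) → + 0 }
  ; l = λ _ → + 0
  ; u = λ _ → + 1
  ; c = λ _ → + 0
  ; isInt = λ _ → false
  }

halvingSolution : ∀ n → Fin (suc n) → ℚ
halvingSolution n j = halfPower (toℕ j)

halvingSolution-feasible : ∀ n → Feasible (halvingInstance n) (halvingSolution n)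
halvingSolution-feasible n = rows
  , (λ j → 0≤1/[] (2 ^ toℕ j) {{ℕₚ.m^n≢0 2 (toℕ j)}})
  , (λ j → 1/[]≤1 (2 ^ toℕ j) {{ℕₚ.m^n≢0 2 (toℕ j)}})
  , λ _ ()
  where
  halvingRow≡0 : ∀ a → ι (+ 1) *ℚ a +ℚ ι -[1+ 1 ] *ℚ (½ *ℚ a) ≡ 0ℚ
  halvingRow≡0 = solve 1 (λ a → con (ι (+ 1)) :* a :+ con (ι -[1+ 1 ]) :* (con ½ :* a) := con 0ℚ) refl
  rows : ∀ i → ∑ (λ j → ι (halvingMatrix n i j) *ℚ halvingSolution n j) ≡ ι (MILP.b (halvingInstance n) i)
  rows Fin.zero    = halving-row₀ (halvingSolution n)
  rows (Fin.suc i) = begin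
    ∑ (λ j → ι (halvingMatrix n (Fin.suc i) j) *ℚ halvingSolution n j)
      ≡⟨ halving-rowₛ i (halvingSolution n) ⟩
    ι (+ 1) *ℚ halfPower (toℕ (inject₁ i)) +ℚ ι -[1+ 1 ] *ℚ halfPower (suc (toℕ i))
      ≡⟨ cong₂ (λ p q → ι (+ 1) *ℚ p +ℚ ι -[1+ 1 ] *ℚ q)
               (cong halfPower (Finₚ.toℕ-inject₁ i)) (halfPower-suc (toℕ i)) ⟩
    ι (+ 1) *ℚ halfPower (toℕ i) +ℚ ι -[1+ 1 ] *ℚ (½ *ℚ halfPower (toℕ i))
      ≡⟨ halvingRow≡0 (halfPower (toℕ i)) ⟩
    0ℚ ∎
    where open ≡-Reasoning

halvingSolution-unique : ∀ n y → Feasible (halvingInstance n) y → ∀ j → y j ≡ halvingSolution n j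
halvingSolution-unique n y (rows , _) j = y≡halfPower (toℕ j) j refl
  where
  y≡halfPower : ∀ r (j : Fin (suc n)) → toℕ j ≡ r → y j ≡ halfPower r
  y≡halfPower zero    Fin.zero    refl = trans (sym (halving-row₀ y)) (rows Fin.zero)
  y≡halfPower (suc r) (Fin.suc i) j≡r  = begin
    y (Fin.suc i)       ≡⟨ halvingRow≡0⇒ (y (inject₁ i)) (y (Fin.suc i)) row ⟩
    ½ *ℚ y (inject₁ i)  ≡⟨ cong (½ *ℚ_) (y≡halfPower r (inject₁ i) i≡r) ⟩
    ½ *ℚ halfPower r    ≡⟨ sym (halfPower-suc r) ⟩
    halfPower (suc r)   ∎
    where
    open ≡-Reasoning
    row = trans (sym (halving-rowₛ i y)) (rows (Fin.suc i))
    i≡r = trans (Finₚ.toℕ-inject₁ i) (ℕₚ.suc-injective j≡r)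

halvingInstance-fractionality : ∀ n → ∃ λ d → Fractionality (halvingInstance n) d × 2 ^ n ≤ d
halvingInstance-fractionality n =
  maxDen (halvingInstance n) (halvingSolution n) ,
  uniqueFeasible⇒Fractionality (halvingInstance n) (λ _ → refl) (halvingSolution n)
    (halvingSolution-feasible n) (halvingSolution-unique n) ,
  subst (_≤ maxDen (halvingInstance n) (halvingSolution n)) ↧ₙ-last≡2^n
    (f≤maxℕ (λ j → ℚ.↧ₙ halvingSolution n j) (fromℕ n))
  where
  ↧ₙ-last≡2^n : ℚ.↧ₙ halvingSolution n (fromℕ n) ≡ 2 ^ n
  ↧ₙ-last≡2^n = trans (cong (λ r → ℚ.↧ₙ halfPower r) (Finₚ.toℕ-fromℕ n)) (↧ₙ-halfPower n)

fourBlockOnes-diagonal : ∀ n (k : Fin n) → fourBlockOnes n (Fin.suc k) (Fin.suc k) ≡ + 1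
fourBlockOnes-diagonal n k with toℕ k ℕ.≟ toℕ k
... | yes _  = refl
... | no k≢k = ⊥-elim (k≢k refl)

fourBlockOnes-offDiagonal : ∀ n (k j : Fin n) → j ≢ k → fourBlockOnes n (Fin.suc k) (Fin.suc j) ≡ + 0
fourBlockOnes-offDiagonal n k j j≢k with toℕ k ℕ.≟ toℕ j
... | yes k≡j = ⊥-elim (j≢k (Finₚ.toℕ-injective (sym k≡j)))
... | no _    = refl

fourBlockOnes-rowₛ : ∀ n (k : Fin n) (x : Fin (suc n) → ℚ) →
  ∑ (λ j → ι (fourBlockOnes n (Fin.suc k) j) *ℚ x j) ≡ x Fin.zero +ℚ x (Fin.suc k)
fourBlockOnes-rowₛ n k x =
  cong₂ _+ℚ_ (ℚₚ.*-identityˡ (x Fin.zero))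
    (∑-select k (λ j → fourBlockOnes n (Fin.suc k) (Fin.suc j)) (λ j → x (Fin.suc j))
      (fourBlockOnes-diagonal n k) (fourBlockOnes-offDiagonal n k))

fourBlockOnes-row₀ : ∀ m (x : Fin (3 ℕ.+ m) → ℚ) → (∀ k → x (Fin.suc k) ≡ - x Fin.zero) →
  ∑ (λ j → ι (fourBlockOnes (suc (suc m)) Fin.zero j) *ℚ x j) ≡ - (ι (+ suc m) *ℚ x Fin.zero)
fourBlockOnes-row₀ m x x≡-x₀ = begin
  ι (+ 1) *ℚ x₀ +ℚ ∑ (λ j → ι (+ 1) *ℚ x (Fin.suc j))
    ≡⟨ cong (ι (+ 1) *ℚ x₀ +ℚ_) (∑-cong (λ j → cong (ι (+ 1) *ℚ_) (x≡-x₀ j))) ⟩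
  ι (+ 1) *ℚ x₀ +ℚ ∑ {suc (suc m)} (λ _ → ι (+ 1) *ℚ - x₀)
    ≡⟨ cong (ι (+ 1) *ℚ x₀ +ℚ_) (∑-const (suc (suc m)) _) ⟩
  ι (+ 1) *ℚ x₀ +ℚ ι (+ suc (suc m)) *ℚ (ι (+ 1) *ℚ - x₀)
    ≡⟨ cong (λ z → ι (+ 1) *ℚ x₀ +ℚ z *ℚ (ι (+ 1) *ℚ - x₀)) (ι-suc (suc m)) ⟩
  ι (+ 1) *ℚ x₀ +ℚ (1ℚ +ℚ ι (+ suc m)) *ℚ (ι (+ 1) *ℚ - x₀)
    ≡⟨ collect x₀ (ι (+ suc m)) ⟩
  - (ι (+ suc m) *ℚ x₀) ∎
  where
  open ≡-Reasoning
  x₀ = x Fin.zero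
  collect : ∀ x s → ι (+ 1) *ℚ x +ℚ (1ℚ +ℚ s) *ℚ (ι (+ 1) *ℚ - x) ≡ - (s *ℚ x)
  collect = solve 2 (λ x s → con (ι (+ 1)) :* x :+ (con 1ℚ :+ s) :* (con (ι (+ 1)) :* (:- x)) := :- (s :* x)) refl

starInstance : ∀ n → MILP (suc n) (suc n)
starInstance n = record
  { A = fourBlockOnes n
  ; b = λ { Fin.zero → -[1+ 0 ] ; (Fin.suc _) → + 0 }
  ; l = λ _ → -[1+ 0 ]
  ; u = λ _ → + 1
  ; c = λ _ → + 0
  ; isInt = λ _ → false
  }

starSolution : ∀ m → Fin (3 ℕ.+ m) → ℚ
starSolution m Fin.zero    = 1/[ suc m ]
starSolution m (Fin.suc _) = - 1/[ suc m ]

starSolution-feasible : ∀ m → Feasible (starInstance (2 ℕ.+ m)) (starSolution m)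
starSolution-feasible m = rows , lower , upper , λ _ ()
  where
  rows : ∀ i → ∑ (λ j → ι (fourBlockOnes (2 ℕ.+ m) i j) *ℚ starSolution m j)
             ≡ ι (MILP.b (starInstance (2 ℕ.+ m)) i)
  rows Fin.zero    = trans (fourBlockOnes-row₀ m (starSolution m) (λ _ → refl)) (cong -_ (ι*1/[] (suc m)))
  rows (Fin.suc k) = trans (fourBlockOnes-rowₛ _ k (starSolution m)) (ℚₚ.+-inverseʳ 1/[ suc m ])
  lower : ∀ j → ι -[1+ 0 ] ℚ.≤ starSolution m j
  lower Fin.zero    = *≤* ℤ.-≤+
  lower (Fin.suc j) = *≤* (ℤ.-≤- z≤n)
  upper : ∀ j → starSolution m j ℚ.≤ ι (+ 1)
  upper Fin.zero    = *≤* (ℤ.+≤+ (s≤s z≤n))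
  upper (Fin.suc j) = *≤* ℤ.-≤+

starSolution-unique : ∀ m y → Feasible (starInstance (2 ℕ.+ m)) y → ∀ j → y j ≡ starSolution m j
starSolution-unique m y (rows , _) = y≡
  where
  leaf≡-root : ∀ k → y (Fin.suc k) ≡ - y Fin.zero
  leaf≡-root k = inverseʳ-unique (y Fin.zero) (y (Fin.suc k))
                   (trans (sym (fourBlockOnes-rowₛ _ k y)) (rows (Fin.suc k)))
  root≡ : y Fin.zero ≡ 1/[ suc m ]
  root≡ = ι*x≡1⇒x≡1/[] (suc m) (y Fin.zero)
            (ℚₚ.neg-injective (trans (sym (fourBlockOnes-row₀ m y leaf≡-root)) (rows Fin.zero)))
  y≡ : ∀ j → y j ≡ starSolution m j
  y≡ Fin.zero    = root≡
  y≡ (Fin.suc k) = trans (leaf≡-root k) (cong -_ root≡)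

starInstance-fractionality : ∀ m → ∃ λ d → Fractionality (starInstance (2 ℕ.+ m)) d × 2 ℕ.+ m ≤ 2 * d
starInstance-fractionality m =
  d , uniqueFeasible⇒Fractionality (starInstance (2 ℕ.+ m)) (λ _ → refl) (starSolution m)
        (starSolution-feasible m) (starSolution-unique m) ,
  (begin
    2 ℕ.+ m        ≤⟨ s≤s (s≤s (ℕₚ.m≤n*m m 2)) ⟩
    2 ℕ.+ 2 * m    ≡⟨ sym (2*suc m) ⟩
    2 * suc m      ≤⟨ ℕₚ.*-monoʳ-≤ 2 (f≤maxℕ (λ j → ℚ.↧ₙ starSolution m j) Fin.zero) ⟩
    2 * d          ∎)
  where
  open ℕₚ.≤-Reasoning
  d = maxDen (starInstance (2 ℕ.+ m)) (starSolution m)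

lemma1 : Σ ℕ λ w → Σ ℕ λ k → Σ ℕ λ n₀ → ∀ n → n₀ ≤ n →
    (Σ ℕ λ m₁ → Σ ℕ λ N₁ → Σ (MILP m₁ N₁) λ I₁ →
        TreewidthAtMost (primalGraph (MILP.A I₁)) w
      × TreewidthAtMost (dualGraph (MILP.A I₁)) w
      × TreewidthAtMost (incidenceGraph (MILP.A I₁)) w
      × NormInf≡ (MILP.A I₁) 2
      × ∃ λ d → Fractionality I₁ d × 2 ^ n ≤ d ^ suc k)
  × (Σ (MILP (suc n) (suc n)) λ I₂ →
        MILP.A I₂ ≡ fourBlockOnes n
      × ∃ λ d → Fractionality I₂ d × n ≤ suc k * d)
lemma1 = 1 , 1 , 2 , λ where
  zero          ()
  (suc zero)    (s≤s ())
  (suc (suc m)) _ →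
    let n = 2 ℕ.+ m
        d , fractionality , 2^n≤d = halvingInstance-fractionality n
        instance d≢0 = ℕ.>-nonZero (ℕₚ.≤-trans (ℕₚ.m^n>0 2 n) 2^n≤d)
    in ( suc n , suc n , halvingInstance n
       , halvingMatrix-primal n , halvingMatrix-dual n , halvingMatrix-incidence n
       , halvingMatrix-norm (suc m)
       , d , fractionality , ℕₚ.≤-trans 2^n≤d (m≤m^[1+n] d 1))
     , (starInstance n , refl , starInstance-fractionality m)
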